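{- Let $n\geq 3$ and let $G_n$ be an $S_{n-1,n-1}$-free subgraph of $Q_n$ having the maximum number of edges among all $S_{n-1,n-1}$-free subgraphs of $Q_n$. If $\delta(G_n)\leq n-2$, then there exists an $S_{n-1,n-1}$-free subgraph $G_n'$ of $Q_n$ with $e(G_n')=e(G_n)$ and $\delta(G_n')=n-1$.
   Context: The $n$-dimensional hypercube $Q_n$ is the graph with vertex set $\{0,1\}^n$ in which two vertices are adjacent if and only if they differ in exactly one coordinate. Subgraphs of $Q_n$ are taken on the full vertex set $\{0,1\}^n$ (spanning subgraphs), so degrees are computed for all $2^n$ vertices. A double star $S_{k,l}$ is the graph obtained by taking an edge $uv$ and joining $u$ to $k$ further vertices and $v$ to $l$ further vertices, all these $k+l$ vertices distinct from each other and from $u,v$. A graph is $H$-free if it contains no subgraph isomorphic to $H$. $e(G)$ is the number of edges and $\delta(G)$ the minimum degree of $G$. -}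

module Defs where

open import Data.Bool using (Bool; true; false; if_then_else_; _xor_)
open import Data.Nat using (ℕ; zero; suc; _+_; _⊓_; ⌊_/2⌋)
open import Data.Vec using (Vec; []; _∷_; replicate; toList; zipWith)
open import Data.List using (List; []; _∷_; map; _++_; foldr)
open import Data.Nat.ListAction using (sum)
open import Data.List.Relation.Unary.Unique.Propositional using (Unique)
open import Data.List.Relation.Unary.All using (All)
open import Data.Product using (Σ; _×_; ∃; _,_)
open import Relation.Binary.PropositionalEquality using (_≡_)
open import Relation.Nullary using (¬_)

Vert : ℕ → Set
Vert n = Vec Bool n

allVerts : (n : ℕ) → List (Vert n)
allVerts zero = [] ∷ []
allVerts (suc n) = map (false ∷_) (allVerts n) ++ map (true ∷_) (allVerts n)

countTrue : List Bool → ℕ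
countTrue [] = 0
countTrue (b ∷ bs) = (if b then 1 else 0) + countTrue bs

hamming : ∀ {n} → Vert n → Vert n → ℕ
hamming u v = countTrue (toList (zipWith _xor_ u v))

Adj : ∀ {n} → Vert n → Vert n → Set
Adj u v = hamming u v ≡ 1

-- A (spanning) subgraph of Q_n: a symmetric edge relation on all of {0,1}^n
-- whose edges are edges of Q_n.
record Subgraph (n : ℕ) : Set where
  field
    edge : Vert n → Vert n → Bool
    edge-sym : ∀ u v → edge u v ≡ edge v u
    edge-sub : ∀ u v → edge u v ≡ true → Adj u v
open Subgraph public

deg : ∀ {n} → Subgraph n → Vert n → ℕ
deg {n} G v = countTrue (map (edge G v) (allVerts n))

-- Number of edges: half the degree sum (handshake).
e : ∀ {n} → Subgraph n → ℕ
e {n} G = ⌊ sum (map (deg G) (allVerts n)) /2⌋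

δ : ∀ {n} → Subgraph n → ℕ
δ {n} G = foldr _⊓_ (deg G (replicate n false)) (map (deg G) (allVerts n))

ContainsDoubleStar : ∀ {n} → ℕ → ℕ → Subgraph n → Set
ContainsDoubleStar {n} k l G =
  Σ (Vert n) λ u → Σ (Vert n) λ v →
  Σ (Vec (Vert n) k) λ A → Σ (Vec (Vert n) l) λ B →
    (edge G u v ≡ true)
    × All (λ a → edge G u a ≡ true) (toList A)
    × All (λ b → edge G v b ≡ true) (toList B)
    × Unique (u ∷ v ∷ toList A ++ toList B)

DoubleStarFree : ∀ {n} → ℕ → ℕ → Subgraph n → Set
DoubleStarFree k l G = ¬ ContainsDoubleStar k l G

module Submission where

-- Write m = n − 1. A copy of S_{m,m} in a subgraph of Q_n forces both ends of its central edge
-- to have degree n, since each end sees the other end and m leaves. Let v have degree < m in a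
-- maximum S_{m,m}-free G and let vw be a cube edge missing from G. By maximality G + vw contains
-- a double star; as v still has degree ≤ m, its central edge is wq for some q ≠ v of degree n.
-- Replacing wq by vw keeps G free and keeps e(G), raises deg v by one and lowers deg q only from
-- n to m, so the deficit Σₓ (m ∸ deg x) strictly drops. Iterating until δ ≥ m ends with δ = m,
-- because some vertex (finally w) always has degree ≤ m.

open import Defs
open import Data.Bool using (Bool; true; false; if_then_else_; _∧_; _∨_; not)
open import Data.Bool.Properties using (∧-comm; ∨-comm; ∧-zeroʳ; xor-comm; T-≡) renaming (_≟_ to _≟ᵇ_)
open import Data.Nat using (ℕ; zero; suc; _+_; _*_; _∸_; _≤_; _<_; z≤n; s≤s; _⊓_; ⌊_/2⌋; _≡ᵇ_; _≤?_; _<?_)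
open import Data.Nat.Properties
open import Data.Nat.ListAction using (sum)
open import Data.Nat.ListAction.Properties using (sum-++)
open import Data.Nat.Induction using (<-wellFounded)
open import Data.Nat.Tactic.RingSolver using (solve-∀)
open import Data.Vec using (Vec; []; _∷_; toList; replicate)
open import Data.Vec.Properties using (length-toList) renaming (≡-dec to ≡-decᵛ)
open import Data.List using (List; []; _∷_; map; _++_; foldr; length)
open import Data.List.Properties using (map-++; map-∘)
open import Data.List.Membership.Propositional using (_∈_; lose)
open import Data.List.Membership.Propositional.Properties using (∈-map⁺; ∈-++⁺ˡ; ∈-++⁺ʳ)
open import Data.List.Relation.Unary.Any using (here; there; any?; satisfied)
open import Data.List.Relation.Unary.All as All using (All; []; _∷_)
open import Data.List.Relation.Unary.All.Properties using (++⁻ˡ; ++⁻ʳ)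
open import Data.List.Relation.Unary.AllPairs using ([]; _∷_)
open import Data.List.Relation.Unary.Unique.Propositional using (Unique)
open import Data.Product using (Σ; _×_; _,_; proj₁; proj₂)
open import Data.Sum using (_⊎_; inj₁; inj₂)
open import Function using (_∘_; Equivalence)
open import Induction.WellFounded using (Acc; acc)
open import Relation.Binary.Definitions using (DecidableEquality)
open import Relation.Binary.PropositionalEquality
open import Relation.Nullary using (¬_; ¬?; Dec; yes; no; does; contradiction; _×-dec_)
open import Relation.Nullary.Decidable using (dec-true; dec-false)
open import Relation.Unary using (Decidable)

toℕ : Bool → ℕ
toℕ b = if b then 1 else 0

toℕ-∧ : ∀ p q → toℕ (p ∧ q) ≡ toℕ p * toℕ q
toℕ-∧ false q = refl
toℕ-∧ true  q = sym (+-identityʳ (toℕ q))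

toℕ-∨ : ∀ p q → (p ≡ true → q ≡ false) → toℕ (p ∨ q) ≡ toℕ p + toℕ q
toℕ-∨ false q _ = refl
toℕ-∨ true  q p⇒¬q rewrite p⇒¬q refl = refl

toℕ-¬∧ : ∀ p q → (p ≡ true → q ≡ true) → toℕ (not p ∧ q) + toℕ p ≡ toℕ q
toℕ-¬∧ false q _ = +-identityʳ (toℕ q)
toℕ-¬∧ true  q p⇒q rewrite p⇒q refl = refl

∨-true : ∀ p q → p ∨ q ≡ true → p ≡ true ⊎ q ≡ true
∨-true true  q _   = inj₁ refl
∨-true false q q≡t = inj₂ q≡t

∧-true : ∀ p q → p ∧ q ≡ true → p ≡ true × q ≡ true
∧-true true true _ = refl , refl

module _ {A : Set} where

  countTrue-map : (f : A → Bool) (xs : List A) → countTrue (map f xs) ≡ sum (map (toℕ ∘ f) xs)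
  countTrue-map f []       = refl
  countTrue-map f (x ∷ xs) = cong (toℕ (f x) +_) (countTrue-map f xs)

  sum-map-cong : {f g : A → ℕ} (xs : List A) → (∀ x → f x ≡ g x) → sum (map f xs) ≡ sum (map g xs)
  sum-map-cong []       f≗g = refl
  sum-map-cong (x ∷ xs) f≗g = cong₂ _+_ (f≗g x) (sum-map-cong xs f≗g)

  sum-map-mono : {f g : A → ℕ} (xs : List A) → (∀ x → f x ≤ g x) → sum (map f xs) ≤ sum (map g xs)
  sum-map-mono []       f≤g = z≤n
  sum-map-mono (x ∷ xs) f≤g = +-mono-≤ (f≤g x) (sum-map-mono xs f≤g)

  sum-map-+ : (f g : A → ℕ) (xs : List A) →
              sum (map (λ x → f x + g x) xs) ≡ sum (map f xs) + sum (map g xs)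
  sum-map-+ f g []       = refl
  sum-map-+ f g (x ∷ xs) = begin
    f x + g x + sum (map (λ x → f x + g x) xs)   ≡⟨ cong (f x + g x +_) (sum-map-+ f g xs) ⟩
    f x + g x + (sum (map f xs) + sum (map g xs)) ≡⟨ +-+-comm (f x) (g x) _ _ ⟩
    f x + sum (map f xs) + (g x + sum (map g xs)) ∎
    where
    open ≡-Reasoning
    +-+-comm : ∀ a b c d → a + b + (c + d) ≡ a + c + (b + d)
    +-+-comm = solve-∀

  sum-map-*ˡ : (k : ℕ) (f : A → ℕ) (xs : List A) → sum (map (λ x → k * f x) xs) ≡ k * sum (map f xs)
  sum-map-*ˡ k f []       = sym (*-zeroʳ k)
  sum-map-*ˡ k f (x ∷ xs) = trans (cong (k * f x +_) (sum-map-*ˡ k f xs)) (sym (*-distribˡ-+ k (f x) _))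

  sum-map-0 : (xs : List A) → sum (map (λ _ → 0) xs) ≡ 0
  sum-map-0 []       = refl
  sum-map-0 (x ∷ xs) = sum-map-0 xs

  foldr-⊓-≤ : (f : A → ℕ) (b : ℕ) {x : A} {xs : List A} → x ∈ xs → foldr _⊓_ b (map f xs) ≤ f x
  foldr-⊓-≤ f b {xs = y ∷ xs} (here refl)  = m⊓n≤m (f y) _
  foldr-⊓-≤ f b {xs = y ∷ xs} (there x∈xs) = ≤-trans (m⊓n≤n (f y) _) (foldr-⊓-≤ f b x∈xs)

  foldr-⊓-sel : (f : A → ℕ) (b : ℕ) (xs : List A) →
                foldr _⊓_ b (map f xs) ≡ b ⊎ Σ A λ x → foldr _⊓_ b (map f xs) ≡ f x
  foldr-⊓-sel f b []       = inj₁ refl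
  foldr-⊓-sel f b (y ∷ xs) with ⊓-sel (f y) (foldr _⊓_ b (map f xs))
  ... | inj₁ min≡fy = inj₂ (y , min≡fy)
  ... | inj₂ min≡rest with foldr-⊓-sel f b xs
  ...   | inj₁ rest≡b       = inj₁ (trans min≡rest rest≡b)
  ...   | inj₂ (x , rest≡fx) = inj₂ (x , trans min≡rest rest≡fx)

  count-<⇒witness : (f g : A → Bool) (xs : List A) →
                    sum (map (toℕ ∘ f) xs) < sum (map (toℕ ∘ g) xs) →
                    Σ A λ x → g x ≡ true × f x ≡ false
  count-<⇒witness f g (x ∷ xs) lt with f x in fx | g x in gx
  ... | false | true  = x , gx , fx
  ... | false | false = count-<⇒witness f g xs lt
  ... | true  | true  = count-<⇒witness f g xs (≤-pred lt)
  ... | true  | false = count-<⇒witness f g xs (<-trans (n<1+n _) lt)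

_≟ᵥ_ : ∀ {n} → DecidableEquality (Vert n)
_≟ᵥ_ = ≡-decᵛ _≟ᵇ_

_==_ : ∀ {n} → Vert n → Vert n → Bool
x == y = does (x ≟ᵥ y)

==-true : ∀ {n} {x y : Vert n} → x == y ≡ true → x ≡ y
==-true {x = x} {y} eq with x ≟ᵥ y
... | yes x≡y = x≡y

𝟙 : ∀ {n} → Vert n → Vert n → ℕ
𝟙 a x = toℕ (x == a)

𝟙-refl : ∀ {n} (a : Vert n) → 𝟙 a a ≡ 1
𝟙-refl a = cong toℕ (dec-true (a ≟ᵥ a) refl)

𝟙-≢ : ∀ {n} {a x : Vert n} → x ≢ a → 𝟙 a x ≡ 0
𝟙-≢ {a = a} {x} x≢a = cong toℕ (dec-false (x ≟ᵥ a) x≢a)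

allVerts-complete : ∀ n (x : Vert n) → x ∈ allVerts n
allVerts-complete zero    []        = here refl
allVerts-complete (suc n) (false ∷ x) = ∈-++⁺ˡ (∈-map⁺ (false ∷_) (allVerts-complete n x))
allVerts-complete (suc n) (true ∷ x)  = ∈-++⁺ʳ _ (∈-map⁺ (true ∷_) (allVerts-complete n x))

vertex-search : ∀ {n} {P : Vert n → Set} → Decidable P → Σ (Vert n) P ⊎ (∀ x → ¬ P x)
vertex-search {n} P? with any? P? (allVerts n)
... | yes ∃P = inj₁ (satisfied ∃P)
... | no ¬∃P = inj₂ λ x Px → ¬∃P (lose (allVerts-complete n x) Px)

vsum : ∀ {n} → (Vert n → ℕ) → ℕ
vsum {n} f = sum (map f (allVerts n))

vsum-∷ : ∀ {n} (f : Vert (suc n) → ℕ) → vsum f ≡ vsum (f ∘ (false ∷_)) + vsum (f ∘ (true ∷_))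
vsum-∷ {n} f = begin
  sum (map f (V₀ ++ V₁))                 ≡⟨ cong sum (map-++ f V₀ V₁) ⟩
  sum (map f V₀ ++ map f V₁)             ≡⟨ sum-++ (map f V₀) (map f V₁) ⟩
  sum (map f V₀) + sum (map f V₁)        ≡⟨ cong₂ _+_ (cong sum (map-∘ (allVerts n))) (cong sum (map-∘ (allVerts n))) ⟨
  vsum (f ∘ (false ∷_)) + vsum (f ∘ (true ∷_)) ∎
  where
  open ≡-Reasoning
  V₀ V₁ : List (Vert (suc n))
  V₀ = map (false ∷_) (allVerts n)
  V₁ = map (true ∷_) (allVerts n)

vsum-0 : ∀ n → vsum {n} (λ _ → 0) ≡ 0
vsum-0 n = sum-map-0 (allVerts n)

vsum-𝟙 : ∀ {n} (a : Vert n) → vsum (𝟙 a) ≡ 1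
vsum-𝟙 []          = refl
vsum-𝟙 {suc n} (false ∷ a) = trans (vsum-∷ (𝟙 (false ∷ a))) (cong₂ _+_ (vsum-𝟙 a) (vsum-0 n))
vsum-𝟙 {suc n} (true ∷ a)  = trans (vsum-∷ (𝟙 (true ∷ a)))  (cong₂ _+_ (vsum-0 n) (vsum-𝟙 a))

module _ {n} {f g : Vert n → ℕ} {a b : Vert n} (shift : ∀ x → f x + 𝟙 a x ≡ g x + 𝟙 b x) where

  vsum-shift : vsum f ≡ vsum g
  vsum-shift = +-cancelʳ-≡ 1 _ _ (begin
    vsum f + 1                  ≡⟨ cong (vsum f +_) (vsum-𝟙 a) ⟨
    vsum f + vsum (𝟙 a)         ≡⟨ sum-map-+ f (𝟙 a) (allVerts n) ⟨
    vsum (λ x → f x + 𝟙 a x)    ≡⟨ sum-map-cong (allVerts n) shift ⟩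
    vsum (λ x → g x + 𝟙 b x)    ≡⟨ sum-map-+ g (𝟙 b) (allVerts n) ⟩
    vsum g + vsum (𝟙 b)         ≡⟨ cong (vsum g +_) (vsum-𝟙 b) ⟩
    vsum g + 1                  ∎)
    where open ≡-Reasoning

  shift-outside : ∀ {x} → x ≢ a → x ≢ b → f x ≡ g x
  shift-outside {x} x≢a x≢b = +-cancelʳ-≡ 0 _ _ (begin
    f x + 0        ≡⟨ cong (f x +_) (𝟙-≢ x≢a) ⟨
    f x + 𝟙 a x    ≡⟨ shift x ⟩
    g x + 𝟙 b x    ≡⟨ cong (g x +_) (𝟙-≢ x≢b) ⟩
    g x + 0        ∎)
    where open ≡-Reasoning

  shift-target : b ≢ a → f b ≡ suc (g b)
  shift-target b≢a = +-cancelʳ-≡ 0 _ _ (begin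
    f b + 0        ≡⟨ cong (f b +_) (𝟙-≢ b≢a) ⟨
    f b + 𝟙 a b    ≡⟨ shift b ⟩
    g b + 𝟙 b b    ≡⟨ cong (g b +_) (𝟙-refl b) ⟩
    g b + 1        ≡⟨ +-comm (g b) 1 ⟩
    suc (g b)      ≡⟨ +-identityʳ (suc (g b)) ⟨
    suc (g b) + 0  ∎)
    where open ≡-Reasoning

  shift-source : a ≢ b → suc (f a) ≡ g a
  shift-source a≢b = begin
    suc (f a)      ≡⟨ +-comm 1 (f a) ⟩
    f a + 1        ≡⟨ cong (f a +_) (𝟙-refl a) ⟨
    f a + 𝟙 a a    ≡⟨ shift a ⟩
    g a + 𝟙 b a    ≡⟨ cong (g a +_) (𝟙-≢ a≢b) ⟩
    g a + 0        ≡⟨ +-identityʳ (g a) ⟩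
    g a            ∎
    where open ≡-Reasoning

  vsum-∸-< : (k : ℕ) → a ≢ b → g b < k → k < g a → vsum (λ x → k ∸ f x) < vsum (λ x → k ∸ g x)
  vsum-∸-< k a≢b gb<k k<ga = begin-strict
    vsum (λ x → k ∸ f x)                    <⟨ m<m+n _ (s≤s z≤n) ⟩
    vsum (λ x → k ∸ f x) + 1                ≡⟨ cong (vsum (λ x → k ∸ f x) +_) (vsum-𝟙 b) ⟨
    vsum (λ x → k ∸ f x) + vsum (𝟙 b)       ≡⟨ sum-map-+ _ _ (allVerts n) ⟨
    vsum (λ x → k ∸ f x + 𝟙 b x)            ≤⟨ sum-map-mono (allVerts n) pointwise ⟩
    vsum (λ x → k ∸ g x)                    ∎
    where
    open ≤-Reasoning
    pointwise : ∀ x → k ∸ f x + 𝟙 b x ≤ k ∸ g x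
    pointwise x with x ≟ᵥ b | x ≟ᵥ a
    ... | yes refl | yes refl = contradiction refl a≢b
    ... | yes refl | no b≢a   rewrite shift-target b≢a = ≤-reflexive (trans (+-comm _ 1) (sym (+-∸-assoc 1 gb<k)))
    ... | no _     | yes refl rewrite m≤n⇒m∸n≡0 (≤-pred (subst (k <_) (sym (shift-source a≢b)) k<ga)) = z≤n
    ... | no x≢b   | no x≢a   rewrite shift-outside x≢a x≢b = ≤-reflexive (+-identityʳ _)

hamming-self : ∀ {n} (x : Vert n) → hamming x x ≡ 0
hamming-self []          = refl
hamming-self (false ∷ x) = hamming-self x
hamming-self (true ∷ x)  = hamming-self x

Adj-irrefl : ∀ {n} {x y : Vert n} → Adj x y → x ≢ y
Adj-irrefl {x = x} xy refl with () ← trans (sym xy) (hamming-self x)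

Adj-sym : ∀ {n} {x y : Vert n} → Adj x y → Adj y x
Adj-sym {x = x} {y} xy = trans (hamming-sym y x) xy
  where
  hamming-sym : ∀ {n} (x y : Vert n) → hamming x y ≡ hamming y x
  hamming-sym []          []          = refl
  hamming-sym (b ∷ x)     (c ∷ y)     = cong₂ _+_ (cong toℕ (xor-comm b c)) (hamming-sym x y)

atDistance : ∀ {n} → ℕ → Vert n → Vert n → ℕ
atDistance d x y = toℕ (hamming x y ≡ᵇ d)

count-atDistance-0 : ∀ {n} (x : Vert n) → vsum (atDistance 0 x) ≡ 1
count-atDistance-0 []                  = refl
count-atDistance-0 {suc n} (false ∷ x) =
  trans (vsum-∷ (atDistance 0 (false ∷ x))) (cong₂ _+_ (count-atDistance-0 x) (vsum-0 n))
count-atDistance-0 {suc n} (true ∷ x)  =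
  trans (vsum-∷ (atDistance 0 (true ∷ x))) (cong₂ _+_ (vsum-0 n) (count-atDistance-0 x))

count-neighbours : ∀ {n} (x : Vert n) → vsum (atDistance 1 x) ≡ n
count-neighbours []                  = refl
count-neighbours {suc n} (false ∷ x) =
  trans (vsum-∷ (atDistance 1 (false ∷ x)))
        (trans (cong₂ _+_ (count-neighbours x) (count-atDistance-0 x)) (+-comm n 1))
count-neighbours {suc n} (true ∷ x)  =
  trans (vsum-∷ (atDistance 1 (true ∷ x))) (cong₂ _+_ (count-atDistance-0 x) (count-neighbours x))

deg-vsum : ∀ {n} (G : Subgraph n) x → deg G x ≡ vsum (toℕ ∘ edge G x)
deg-vsum {n} G x = countTrue-map (edge G x) (allVerts n)

deg≤n : ∀ {n} (G : Subgraph n) x → deg G x ≤ n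
deg≤n {n} G x = begin
  deg G x                                   ≡⟨ deg-vsum G x ⟩
  vsum (toℕ ∘ edge G x)                     ≤⟨ sum-map-mono (allVerts n) edge≤adjacent ⟩
  vsum (atDistance 1 x)                     ≡⟨ count-neighbours x ⟩
  n                                         ∎
  where
  open ≤-Reasoning
  edge≤adjacent : ∀ y → toℕ (edge G x y) ≤ atDistance 1 x y
  edge≤adjacent y with edge G x y in xy
  ... | false = z≤n
  ... | true rewrite edge-sub G x y xy = ≤-refl

missing-neighbour : ∀ {n} (G : Subgraph n) x → deg G x < n → Σ (Vert n) λ y → Adj x y × edge G x y ≡ false
missing-neighbour {n} G x deg<n with count-<⇒witness (edge G x) (λ y → hamming x y ≡ᵇ 1) (allVerts n)
                                       (subst₂ _<_ (deg-vsum G x) (sym (count-neighbours x)) deg<n)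
... | y , xy∈Qₙ , xy∉G = y , ≡ᵇ⇒≡ (hamming x y) 1 (Equivalence.from T-≡ xy∈Qₙ) , xy∉G

unique-≤-count : ∀ {n} (f : Vert n → Bool) (xs : List (Vert n)) →
                 Unique xs → All (λ y → f y ≡ true) xs → length xs ≤ vsum (toℕ ∘ f)
unique-≤-count f []       _             _          = z≤n
unique-≤-count {n} f (x ∷ xs) (x∉xs ∷ uxs) (fx ∷ fxs) = begin
  suc (length xs)               ≤⟨ s≤s (unique-≤-count f⁻ xs uxs (All.zipWith f⁻-true (x∉xs , fxs))) ⟩
  suc (vsum (toℕ ∘ f⁻))         ≡⟨ +-comm 1 _ ⟩
  vsum (toℕ ∘ f⁻) + 1           ≡⟨ cong (vsum (toℕ ∘ f⁻) +_) (vsum-𝟙 x) ⟨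
  vsum (toℕ ∘ f⁻) + vsum (𝟙 x)  ≡⟨ sum-map-+ (toℕ ∘ f⁻) (𝟙 x) (allVerts n) ⟨
  vsum (λ y → toℕ (f⁻ y) + 𝟙 x y) ≡⟨ sum-map-cong (allVerts n) f⁻+𝟙≡f ⟩
  vsum (toℕ ∘ f)                ∎
  where
  open ≤-Reasoning
  f⁻ : Vert n → Bool
  f⁻ y = not (y == x) ∧ f y
  f⁻-true : ∀ {y} → x ≢ y × f y ≡ true → f⁻ y ≡ true
  f⁻-true {y} (x≢y , fy) rewrite dec-false (y ≟ᵥ x) (x≢y ∘ sym) = fy
  f⁻+𝟙≡f : ∀ y → toℕ (f⁻ y) + 𝟙 x y ≡ toℕ (f y)
  f⁻+𝟙≡f y = toℕ-¬∧ (y == x) (f y) (λ y=x → subst (λ z → f z ≡ true) (sym (==-true y=x)) fx)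

δ≤deg : ∀ {n} (G : Subgraph n) x → δ G ≤ deg G x
δ≤deg {n} G x = foldr-⊓-≤ (deg G) _ (allVerts-complete n x)

δ-attained : ∀ {n} (G : Subgraph n) → Σ (Vert n) λ x → δ G ≡ deg G x
δ-attained {n} G with foldr-⊓-sel (deg G) (deg G (replicate n false)) (allVerts n)
... | inj₁ δ≡deg₀   = replicate n false , δ≡deg₀
... | inj₂ attained = attained

pair : ∀ {n} → Vert n → Vert n → Vert n → Vert n → Bool
pair a b x y = (x == a ∧ y == b) ∨ (x == b ∧ y == a)

pair-sym : ∀ {n} (a b x y : Vert n) → pair a b x y ≡ pair a b y x
pair-sym a b x y = trans (∨-comm (x == a ∧ y == b) _) (cong₂ _∨_ (∧-comm (x == b) _) (∧-comm (x == a) _))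

pair-true : ∀ {n} (a b x y : Vert n) → pair a b x y ≡ true → (x ≡ a × y ≡ b) ⊎ (x ≡ b × y ≡ a)
pair-true a b x y xy=ab with ∨-true (x == a ∧ y == b) _ xy=ab
... | inj₁ xayb = let xa , yb = ∧-true _ _ xayb in inj₁ (==-true xa , ==-true yb)
... | inj₂ xbya = let xb , ya = ∧-true _ _ xbya in inj₂ (==-true xb , ==-true ya)

pair-outside : ∀ {n} {a b x : Vert n} (y : Vert n) → x ≢ a → x ≢ b → pair a b x y ≡ false
pair-outside {a = a} {b} {x} y x≢a x≢b rewrite dec-false (x ≟ᵥ a) x≢a | dec-false (x ≟ᵥ b) x≢b = refl

pair-edge : ∀ {n} (G : Subgraph n) {a b x y : Vert n} {c : Bool} →
            edge G a b ≡ c → pair a b x y ≡ true → edge G x y ≡ c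
pair-edge G {a} {b} {x} {y} ab≡c xy=ab with pair-true a b x y xy=ab
... | inj₁ (refl , refl) = ab≡c
... | inj₂ (refl , refl) = trans (edge-sym G x y) ab≡c

vsum-pair : ∀ {n} {a b : Vert n} → a ≢ b → (x : Vert n) → vsum (toℕ ∘ pair a b x) ≡ 𝟙 a x + 𝟙 b x
vsum-pair {n} {a} {b} a≢b x = begin
  vsum (toℕ ∘ pair a b x)
    ≡⟨ sum-map-cong (allVerts n) split ⟩
  vsum (λ y → 𝟙 a x * 𝟙 b y + 𝟙 b x * 𝟙 a y)
    ≡⟨ sum-map-+ _ _ (allVerts n) ⟩
  vsum (λ y → 𝟙 a x * 𝟙 b y) + vsum (λ y → 𝟙 b x * 𝟙 a y)
    ≡⟨ cong₂ _+_ (sum-map-*ˡ (𝟙 a x) (𝟙 b) (allVerts n)) (sum-map-*ˡ (𝟙 b x) (𝟙 a) (allVerts n)) ⟩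
  𝟙 a x * vsum (𝟙 b) + 𝟙 b x * vsum (𝟙 a)
    ≡⟨ cong₂ (λ s t → 𝟙 a x * s + 𝟙 b x * t) (vsum-𝟙 b) (vsum-𝟙 a) ⟩
  𝟙 a x * 1 + 𝟙 b x * 1
    ≡⟨ cong₂ _+_ (*-identityʳ (𝟙 a x)) (*-identityʳ (𝟙 b x)) ⟩
  𝟙 a x + 𝟙 b x ∎
  where
  open ≡-Reasoning
  x=a⇒x≠b : ∀ y → x == a ∧ y == b ≡ true → x == b ∧ y == a ≡ false
  x=a⇒x≠b y xayb rewrite dec-false (x ≟ᵥ b) (a≢b ∘ trans (sym (==-true (proj₁ (∧-true _ _ xayb))))) = refl
  split : ∀ y → toℕ (pair a b x y) ≡ 𝟙 a x * 𝟙 b y + 𝟙 b x * 𝟙 a y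
  split y = trans (toℕ-∨ _ _ (x=a⇒x≠b y)) (cong₂ _+_ (toℕ-∧ (x == a) (y == b)) (toℕ-∧ (x == b) (y == a)))

addEdge : ∀ {n} (G : Subgraph n) (a b : Vert n) → Adj a b → Subgraph n
edge     (addEdge G a b ab) x y = pair a b x y ∨ edge G x y
edge-sym (addEdge G a b ab) x y = cong₂ _∨_ (pair-sym a b x y) (edge-sym G x y)
edge-sub (addEdge G a b ab) x y xy∈G⁺ with ∨-true (pair a b x y) _ xy∈G⁺
... | inj₂ xy∈G = edge-sub G x y xy∈G
... | inj₁ xy=ab with pair-true a b x y xy=ab
...   | inj₁ (refl , refl) = ab
...   | inj₂ (refl , refl) = Adj-sym {x = a} ab

deleteEdge : ∀ {n} (G : Subgraph n) (a b : Vert n) → Subgraph n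
edge     (deleteEdge G a b) x y = not (pair a b x y) ∧ edge G x y
edge-sym (deleteEdge G a b) x y = cong₂ (λ p q → not p ∧ q) (pair-sym a b x y) (edge-sym G x y)
edge-sub (deleteEdge G a b) x y xy∈G⁻ = edge-sub G x y (proj₂ (∧-true _ _ xy∈G⁻))

addEdge-outside : ∀ {n} (G : Subgraph n) {a b : Vert n} (ab : Adj a b) {x : Vert n} (y : Vert n) →
                  x ≢ a → x ≢ b → edge (addEdge G a b ab) x y ≡ edge G x y
addEdge-outside G ab y x≢a x≢b = cong (_∨ edge G _ y) (pair-outside y x≢a x≢b)

deg-addEdge : ∀ {n} (G : Subgraph n) {a b : Vert n} (ab : Adj a b) → edge G a b ≡ false →
              ∀ x → deg (addEdge G a b ab) x ≡ deg G x + (𝟙 a x + 𝟙 b x)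
deg-addEdge {n} G {a} {b} ab ab∉G x = begin
  deg (addEdge G a b ab) x
    ≡⟨ deg-vsum (addEdge G a b ab) x ⟩
  vsum (λ y → toℕ (pair a b x y ∨ edge G x y))
    ≡⟨ sum-map-cong (allVerts n) (λ y → toℕ-∨ _ _ (pair-edge G ab∉G)) ⟩
  vsum (λ y → toℕ (pair a b x y) + toℕ (edge G x y))
    ≡⟨ sum-map-+ _ _ (allVerts n) ⟩
  vsum (toℕ ∘ pair a b x) + vsum (toℕ ∘ edge G x)
    ≡⟨ cong₂ _+_ (vsum-pair (Adj-irrefl ab) x) (sym (deg-vsum G x)) ⟩
  𝟙 a x + 𝟙 b x + deg G x
    ≡⟨ +-comm _ (deg G x) ⟩
  deg G x + (𝟙 a x + 𝟙 b x) ∎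
  where open ≡-Reasoning

deg-deleteEdge : ∀ {n} (G : Subgraph n) {a b : Vert n} → edge G a b ≡ true →
                 ∀ x → deg (deleteEdge G a b) x + (𝟙 a x + 𝟙 b x) ≡ deg G x
deg-deleteEdge {n} G {a} {b} ab∈G x = begin
  deg (deleteEdge G a b) x + (𝟙 a x + 𝟙 b x)
    ≡⟨ cong₂ _+_ (deg-vsum (deleteEdge G a b) x) (sym (vsum-pair a≢b x)) ⟩
  vsum (λ y → toℕ (not (pair a b x y) ∧ edge G x y)) + vsum (toℕ ∘ pair a b x)
    ≡⟨ sum-map-+ _ _ (allVerts n) ⟨
  vsum (λ y → toℕ (not (pair a b x y) ∧ edge G x y) + toℕ (pair a b x y))
    ≡⟨ sum-map-cong (allVerts n) (λ y → toℕ-¬∧ _ _ (pair-edge G ab∈G)) ⟩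
  vsum (toℕ ∘ edge G x)
    ≡⟨ deg-vsum G x ⟨
  deg G x ∎
  where
  open ≡-Reasoning
  a≢b : a ≢ b
  a≢b = Adj-irrefl (edge-sub G a b ab∈G)

module _ {n} (G : Subgraph n) {a b : Vert n} (ab : Adj a b) (ab∉G : edge G a b ≡ false) where

  private
    a≢b : a ≢ b
    a≢b = Adj-irrefl ab

  deg-addEdge-source : deg (addEdge G a b ab) a ≡ suc (deg G a)
  deg-addEdge-source = begin
    deg (addEdge G a b ab) a      ≡⟨ deg-addEdge G ab ab∉G a ⟩
    deg G a + (𝟙 a a + 𝟙 b a)    ≡⟨ cong (deg G a +_) (cong₂ _+_ (𝟙-refl a) (𝟙-≢ {a = b} {a} a≢b)) ⟩
    deg G a + 1                   ≡⟨ +-comm (deg G a) 1 ⟩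
    suc (deg G a)                 ∎
    where open ≡-Reasoning

  deg-addEdge-target : deg (addEdge G a b ab) b ≡ suc (deg G b)
  deg-addEdge-target = begin
    deg (addEdge G a b ab) b      ≡⟨ deg-addEdge G ab ab∉G b ⟩
    deg G b + (𝟙 a b + 𝟙 b b)    ≡⟨ cong (deg G b +_) (cong₂ _+_ (𝟙-≢ {a = a} {b} (a≢b ∘ sym)) (𝟙-refl b)) ⟩
    deg G b + 1                   ≡⟨ +-comm (deg G b) 1 ⟩
    suc (deg G b)                 ∎
    where open ≡-Reasoning

  deg-addEdge-outside : ∀ {x} → x ≢ a → x ≢ b → deg (addEdge G a b ab) x ≡ deg G x
  deg-addEdge-outside {x} x≢a x≢b = begin
    deg (addEdge G a b ab) x      ≡⟨ deg-addEdge G ab ab∉G x ⟩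
    deg G x + (𝟙 a x + 𝟙 b x)    ≡⟨ cong (deg G x +_) (cong₂ _+_ (𝟙-≢ x≢a) (𝟙-≢ x≢b)) ⟩
    deg G x + 0                   ≡⟨ +-identityʳ (deg G x) ⟩
    deg G x                       ∎
    where open ≡-Reasoning

e-addEdge : ∀ {n} (G : Subgraph n) {a b : Vert n} (ab : Adj a b) → edge G a b ≡ false →
            e (addEdge G a b ab) ≡ suc (e G)
e-addEdge {n} G {a} {b} ab ab∉G = cong ⌊_/2⌋ (begin
  vsum (deg (addEdge G a b ab))                 ≡⟨ sum-map-cong (allVerts n) (deg-addEdge G ab ab∉G) ⟩
  vsum (λ x → deg G x + (𝟙 a x + 𝟙 b x))       ≡⟨ sum-map-+ _ _ (allVerts n) ⟩
  vsum (deg G) + vsum (λ x → 𝟙 a x + 𝟙 b x)    ≡⟨ cong (vsum (deg G) +_) (sum-map-+ _ _ (allVerts n)) ⟩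
  vsum (deg G) + (vsum (𝟙 a) + vsum (𝟙 b))     ≡⟨ cong (vsum (deg G) +_) (cong₂ _+_ (vsum-𝟙 a) (vsum-𝟙 b)) ⟩
  vsum (deg G) + 2                              ≡⟨ +-comm _ 2 ⟩
  2 + vsum (deg G)                              ∎)
  where open ≡-Reasoning

rotateEdge : ∀ {n} (G : Subgraph n) {v w : Vert n} → Adj v w → Vert n → Subgraph n
rotateEdge G {v} {w} vw q = addEdge (deleteEdge G w q) v w vw

rotateEdge-outside : ∀ {n} (G : Subgraph n) {v w : Vert n} (vw : Adj v w) (q : Vert n) {x : Vert n} (y : Vert n) →
                     x ≢ v → x ≢ w → edge (rotateEdge G vw q) x y ≡ true → edge G x y ≡ true
rotateEdge-outside G {v} {w} vw q y x≢v x≢w xy∈G' =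
  proj₂ (∧-true _ _ (trans (sym (addEdge-outside (deleteEdge G w q) vw y x≢v x≢w)) xy∈G'))

deg-rotateEdge : ∀ {n} (G : Subgraph n) {v w : Vert n} (vw : Adj v w) {q : Vert n} →
                 edge G w q ≡ true → edge G v w ≡ false →
                 ∀ x → deg (rotateEdge G vw q) x + 𝟙 q x ≡ deg G x + 𝟙 v x
deg-rotateEdge G {v} {w} vw {q} wq∈G vw∉G x = begin
  deg (rotateEdge G vw q) x + 𝟙 q x          ≡⟨ cong (_+ 𝟙 q x) (deg-addEdge G⁻ vw vw∉G⁻ x) ⟩
  deg G⁻ x + (𝟙 v x + 𝟙 w x) + 𝟙 q x        ≡⟨ regroup (deg G⁻ x) (𝟙 v x) (𝟙 w x) (𝟙 q x) ⟩
  deg G⁻ x + (𝟙 w x + 𝟙 q x) + 𝟙 v x        ≡⟨ cong (_+ 𝟙 v x) (deg-deleteEdge G wq∈G x) ⟩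
  deg G x + 𝟙 v x                            ∎
  where
  open ≡-Reasoning
  G⁻ : Subgraph _
  G⁻ = deleteEdge G w q
  vw∉G⁻ : edge G⁻ v w ≡ false
  vw∉G⁻ rewrite vw∉G = ∧-zeroʳ _
  regroup : ∀ d a b c → d + (a + b) + c ≡ d + (b + c) + a
  regroup = solve-∀

e-rotateEdge : ∀ {n} (G : Subgraph n) {v w : Vert n} (vw : Adj v w) {q : Vert n} →
               edge G w q ≡ true → edge G v w ≡ false → e (rotateEdge G vw q) ≡ e G
e-rotateEdge G vw {q} wq∈G vw∉G =
  cong ⌊_/2⌋ (vsum-shift (deg-rotateEdge G vw wq∈G vw∉G))

Unique-++⁻ : ∀ {A : Set} (xs : List A) {ys : List A} → Unique (xs ++ ys) → Unique xs × Unique ys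
Unique-++⁻ []       u            = [] , u
Unique-++⁻ (x ∷ xs) (x∉ ∷ u) with Unique-++⁻ xs u
... | uxs , uys = ++⁻ˡ xs x∉ ∷ uxs , uys

doubleStar-degrees : ∀ {n k l} (H : Subgraph n) {u v : Vert n} {A : Vec (Vert n) k} {B : Vec (Vert n) l} →
                     edge H u v ≡ true → All (λ a → edge H u a ≡ true) (toList A) →
                     All (λ b → edge H v b ≡ true) (toList B) → Unique (u ∷ v ∷ toList A ++ toList B) →
                     k < deg H u × l < deg H v
doubleStar-degrees {n} {k} {l} H {u} {v} {A} {B} uv uA vB ((_ ∷ u∉AB) ∷ v∉AB ∷ uAB) =
  leaves<deg (edge H u) (v ∷ toList A) (cong suc (length-toList A))
             (++⁻ˡ (toList A) v∉AB ∷ uA′) (uv ∷ uA) (deg-vsum H u) ,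
  leaves<deg (edge H v) (u ∷ toList B) (cong suc (length-toList B))
             (++⁻ʳ (toList A) u∉AB ∷ uB′) (trans (edge-sym H v u) uv ∷ vB) (deg-vsum H v)
  where
  uA′ : Unique (toList A)
  uA′ = proj₁ (Unique-++⁻ (toList A) uAB)
  uB′ : Unique (toList B)
  uB′ = proj₂ (Unique-++⁻ (toList A) uAB)
  leaves<deg : ∀ {j d} (f : Vert n → Bool) (xs : List (Vert n)) → length xs ≡ suc j →
               Unique xs → All (λ y → f y ≡ true) xs → d ≡ vsum (toℕ ∘ f) → j < d
  leaves<deg f xs len uxs fxs refl = subst (_≤ vsum (toℕ ∘ f)) len (unique-≤-count f xs uxs fxs)

-- Every edge of a double star touches its central edge, so a double star of H whose central
-- edge avoids v and w is already a double star of G.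
doubleStarFree-transfer : ∀ {n k} (G H : Subgraph n) (v w : Vert n) →
                          (∀ x y → x ≢ v → x ≢ w → edge H x y ≡ true → edge G x y ≡ true) →
                          deg H v ≤ k →
                          (∀ y → edge H w y ≡ true → y ≢ v → k < deg H y → deg H w ≤ k) →
                          DoubleStarFree k k G → DoubleStarFree k k H
doubleStarFree-transfer G H v w H⊆G dv≤k w-ok G-free (x , y , A , B , xy , xA , yB , uniq)
  with doubleStar-degrees H xy xA yB uniq
... | k<dx , k<dy with x ≟ᵥ v | y ≟ᵥ v
... | yes refl | _        = <⇒≱ k<dx dv≤k
... | no _     | yes refl = <⇒≱ k<dy dv≤k
... | no x≢v   | no y≢v with x ≟ᵥ w | y ≟ᵥ w
... | yes refl | _        = <⇒≱ k<dx (w-ok y xy y≢v k<dy)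
... | no _     | yes refl = <⇒≱ k<dy (w-ok x (trans (edge-sym H y x) xy) x≢v k<dx)
... | no x≢w   | no y≢w   =
  G-free (x , y , A , B , H⊆G x y x≢v x≢w xy ,
          All.map (H⊆G x _ x≢v x≢w) xA , All.map (H⊆G y _ y≢v y≢w) yB , uniq)

Maximal : ∀ {n} (k : ℕ) → Subgraph n → Set
Maximal {n} k G = (H : Subgraph n) → DoubleStarFree k k H → e H ≤ e G

deficit : ∀ {n} (k : ℕ) → Subgraph n → ℕ
deficit k G = vsum (λ x → k ∸ deg G x)

heavy-neighbour : ∀ {m} (G : Subgraph (suc m)) → DoubleStarFree m m G → Maximal m G →
                  {v w : Vert (suc m)} (vw : Adj v w) → edge G v w ≡ false → deg G v < m →
                  Σ (Vert (suc m)) λ q → edge G w q ≡ true × m < deg G q × q ≢ v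
heavy-neighbour {m} G free maximal {v} {w} vw vw∉G dv<m with vertex-search heavy?
  where
  heavy? : ∀ q → Dec (edge G w q ≡ true × m < deg G q × q ≢ v)
  heavy? q = (edge G w q ≟ᵇ true) ×-dec (m <? deg G q) ×-dec ¬? (q ≟ᵥ v)
... | inj₁ found    = found
... | inj₂ no-heavy = contradiction (maximal G⁺ G⁺-free) (<⇒≱ (≤-reflexive (sym (e-addEdge G vw vw∉G))))
  where
  G⁺ : Subgraph (suc m)
  G⁺ = addEdge G v w vw
  G⁺-free : DoubleStarFree m m G⁺
  G⁺-free = doubleStarFree-transfer G G⁺ v w
    (λ x y x≢v x≢w → subst (_≡ true) (addEdge-outside G vw y x≢v x≢w))
    (subst (_≤ m) (sym (deg-addEdge-source G vw vw∉G)) dv<m)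
    (λ y wy∈G⁺ y≢v m<dy → contradiction (heavy-in-G y wy∈G⁺ y≢v m<dy) (no-heavy y))
    free
    where
    heavy-in-G : ∀ y → edge G⁺ w y ≡ true → y ≢ v → m < deg G⁺ y →
                 edge G w y ≡ true × m < deg G y × y ≢ v
    heavy-in-G y wy∈G⁺ y≢v m<dy =
      trans (edge-sym G w y) (subst (_≡ true) (addEdge-outside G vw w y≢v y≢w) (trans (edge-sym G⁺ y w) wy∈G⁺)) ,
      subst (m <_) (deg-addEdge-outside G vw vw∉G y≢v y≢w) m<dy ,
      y≢v
      where
      y≢w : y ≢ w
      y≢w = Adj-irrefl (edge-sub G⁺ w y wy∈G⁺) ∘ sym

improve : ∀ {m} (G : Subgraph (suc m)) → DoubleStarFree m m G → Maximal m G →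
          (v : Vert (suc m)) → deg G v < m →
          Σ (Subgraph (suc m)) λ G' → DoubleStarFree m m G' × e G' ≡ e G × deficit m G' < deficit m G
                                    × Σ (Vert (suc m)) λ w → deg G' w ≤ m
improve {m} G free maximal v dv<m with missing-neighbour G v (m<n⇒m<1+n dv<m)
... | w , vw , vw∉G with heavy-neighbour G free maximal vw vw∉G dv<m
... | q , wq∈G , m<dq , q≢v =
  G' , G'-free , e-rotateEdge G vw wq∈G vw∉G , vsum-∸-< shift m q≢v dv<m m<dq , w , dw′≤m
  where
  G' : Subgraph (suc m)
  G' = rotateEdge G vw q
  shift : ∀ x → deg G' x + 𝟙 q x ≡ deg G x + 𝟙 v x
  shift = deg-rotateEdge G vw wq∈G vw∉G
  dw≤m : deg G w ≤ m
  dw≤m = ≤-pred (subst (_≤ suc m) (deg-addEdge-target G vw vw∉G) (deg≤n (addEdge G v w vw) w))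
  dw′≤m : deg G' w ≤ m
  dw′≤m = subst (_≤ m) (sym (shift-outside shift (Adj-irrefl (edge-sub G w q wq∈G)) (Adj-irrefl vw ∘ sym))) dw≤m
  dv′≤m : deg G' v ≤ m
  dv′≤m = subst (_≤ m) (sym (shift-target shift (q≢v ∘ sym))) dv<m
  G'-free : DoubleStarFree m m G'
  G'-free = doubleStarFree-transfer G G' v w (λ x y → rotateEdge-outside G vw q y)
                                    dv′≤m (λ _ _ _ _ → dw′≤m) free

Maximal-resp-e : ∀ {n k} {G G' : Subgraph n} → e G' ≡ e G → Maximal k G → Maximal k G'
Maximal-resp-e e≡ maximal H H-free = subst (e H ≤_) (sym e≡) (maximal H H-free)

Outcome : ∀ {m} → Subgraph (suc m) → Set
Outcome {m} G = Σ (Subgraph (suc m)) λ G' → DoubleStarFree m m G' × e G' ≡ e G × δ G' ≡ m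

Outcome-resp-e : ∀ {m} {G' G : Subgraph (suc m)} → e G' ≡ e G → Outcome G' → Outcome G
Outcome-resp-e e≡ (G'' , free'' , e≡′ , δ≡m) = G'' , free'' , trans e≡′ e≡ , δ≡m

iterate : ∀ {m} (G : Subgraph (suc m)) → DoubleStarFree m m G → Maximal m G →
          (x : Vert (suc m)) → deg G x ≤ m → Acc _<_ (deficit m G) → Outcome G
iterate {m} G free maximal x dx≤m (acc smaller) = step (m ≤? δ G)
  where
  step : Dec (m ≤ δ G) → Outcome G
  step (yes m≤δ) = G , free , refl , ≤-antisym (≤-trans (δ≤deg G x) dx≤m) m≤δ
  step (no  m≰δ) =
    let v , δ≡dv = δ-attained G
        G' , free' , e≡ , deficit< , w , dw≤m = improve G free maximal v (subst (_< m) δ≡dv (≰⇒> m≰δ))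
    in Outcome-resp-e {G' = G'} {G} e≡
         (iterate G' free' (Maximal-resp-e {G = G} {G'} e≡ maximal) w dw≤m (smaller deficit<))

-- The hypothesis 3 ≤ n only rules out n = 0; the argument works for every n ≥ 1.
claim2p1 : (n : ℕ) → 3 ≤ n → (G : Subgraph n) → DoubleStarFree (n ∸ 1) (n ∸ 1) G
    → ((H : Subgraph n) → DoubleStarFree (n ∸ 1) (n ∸ 1) H → e H ≤ e G)
    → δ G ≤ n ∸ 2
    → Σ (Subgraph n) λ G' → DoubleStarFree (n ∸ 1) (n ∸ 1) G' × e G' ≡ e G × δ G' ≡ n ∸ 1
claim2p1 zero    ()
claim2p1 (suc m) _ G free maximal δ≤m∸1 =
  let x , δ≡dx = δ-attained G
  in iterate G free maximal x (subst (_≤ m) δ≡dx (≤-trans δ≤m∸1 (m∸n≤m m 1))) (<-wellFounded _)
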